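{- Let $G$ be a bridgeless graph and let $d\ge2$, $k\ge2$, $l\ge1$ be integers. Suppose $G$ admits an oriented $k$-cycle $2l$-cover $\{C_1,\dots,C_k\}$. Then for any vectors $P_1,\dots,P_k\in\mathbb{R}^d$, $G$ admits a vector $\Omega$-flow, where $$\Omega=\Bigl\{\sum_{i\in I}P_i-\sum_{j\in J}P_j : I,J\subseteq\{1,\dots,k\},\ |I|=|J|=l,\ I\cap J=\varnothing\Bigr\}.$$
   Context: All graphs are finite and may have multiple edges but no loops. A cycle is a subgraph in which every vertex has even degree; a cycle in a directed graph is directed if every vertex has equal in- and out-degree. An oriented $k$-cycle $2l$-cover of $G$ is a family of $k$ directed cycles such that each edge of $G$ is covered exactly $2l$ times, $l$ times in each direction. For an orientation $D$ and vertex $v$, $E_D^+(v)$, $E_D^-(v)$ are the out- and in-edges. For $\Omega\subseteq\mathbb{R}^d$, a vector $\Omega$-flow of $G$ is a pair $(D,f)$ with $D$ an orientation of $G$ and $f:E(G)\to\Omega$ satisfying $\sum_{e\in E_D^+(v)}f(e)-\sum_{e\in E_D^-(v)}f(e)=\mathbf{0}$ at every vertex $v$. -}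

module Defs where

open import Level using (Level)
open import Data.Nat using (ℕ; zero; suc) renaming (_+_ to _+ℕ_)
open import Data.Vec using (lookup)
open import Data.Fin using (Fin; zero; suc; _≟_)
open import Data.Fin.Subset using (Subset; _∈_; _∉_; ∣_∣)
open import Data.Bool using (Bool; true; false; if_then_else_)
open import Data.Product using (_×_; Σ; ∃; ∃-syntax; _,_)
open import Data.Sum using (_⊎_)
open import Relation.Nullary using (¬_; yes; no)
open import Relation.Binary.PropositionalEquality using (_≡_; _≢_)
open import Algebra.Bundles using (CommutativeRing)

-- Finite multigraphs without loops.
-- Vertices are Fin nV, edges are Fin nE; each edge e has a reference
-- pair of ends (tl e , hd e) with tl e ≢ hd e (no loops, parallel
-- edges allowed).

record Graph : Set where
  field
    nV nE  : ℕ
    tl hd  : Fin nE → Fin nV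
    noLoop : ∀ e → tl e ≢ hd e
open Graph public

Joins : (G : Graph) → Fin (nE G) → Fin (nV G) → Fin (nV G) → Set
Joins G e u w = (tl G e ≡ u × hd G e ≡ w) ⊎ (hd G e ≡ u × tl G e ≡ w)

data ReachWithout (G : Graph) (e : Fin (nE G)) : Fin (nV G) → Fin (nV G) → Set where
  here : ∀ {u} → ReachWithout G e u u
  step : ∀ {u w v} (e' : Fin (nE G)) → e' ≢ e → Joins G e' u w →
         ReachWithout G e w v → ReachWithout G e u v

IsBridge : (G : Graph) → Fin (nE G) → Set
IsBridge G e = ¬ ReachWithout G e (tl G e) (hd G e)

Bridgeless : Graph → Set
Bridgeless G = ∀ e → ¬ IsBridge G e

count : ∀ {n} → (Fin n → Bool) → ℕ
count {zero}  p = 0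
count {suc n} p = (if p zero then 1 else 0) +ℕ count (λ i → p (suc i))

_==_ : ∀ {n} → Fin n → Fin n → Bool
i == j with i ≟ j
... | yes _ = true
... | no  _ = false

Orientation : Graph → Set
Orientation G = Fin (nE G) → Bool

tail : (G : Graph) → Orientation G → Fin (nE G) → Fin (nV G)
tail G D e = if D e then tl G e else hd G e

head : (G : Graph) → Orientation G → Fin (nE G) → Fin (nV G)
head G D e = if D e then hd G e else tl G e

-- Directed cycles of G: a subgraph of G together with an orientation
-- of its edges such that every vertex has equal in- and out-degree.
-- An edge is either absent, used forward (tl → hd) or backward.

data Use : Set where
  absent fwd bwd : Use

isFwd isBwd : Use → Bool
isFwd fwd = true
isFwd _   = false
isBwd bwd = true
isBwd _   = false

leaves : (G : Graph) → (Fin (nE G) → Use) → Fin (nV G) → Fin (nE G) → Bool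
leaves G C v e with C e
... | absent = false
... | fwd    = tl G e == v
... | bwd    = hd G e == v

enters : (G : Graph) → (Fin (nE G) → Use) → Fin (nV G) → Fin (nE G) → Bool
enters G C v e with C e
... | absent = false
... | fwd    = hd G e == v
... | bwd    = tl G e == v

IsDirectedCycle : (G : Graph) → (Fin (nE G) → Use) → Set
IsDirectedCycle G C = ∀ v → count (leaves G C v) ≡ count (enters G C v)

IsOrientedCycleCover : (G : Graph) (k l : ℕ) → (Fin k → Fin (nE G) → Use) → Set
IsOrientedCycleCover G k l C =
  (∀ i → IsDirectedCycle G (C i)) ×
  (∀ e → count (λ i → isFwd (C i e)) ≡ l × count (λ i → isBwd (C i e)) ≡ l)

-- Vectors over a commutative ring R (R = ℝ in the paper), R^d = Fin d → R.

module Over {c ℓ : Level} (R : CommutativeRing c ℓ) where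
  open CommutativeRing R using (Carrier; _≈_; _+_; _-_; 0#)

  Vect : ℕ → Set c
  Vect d = Fin d → Carrier

  _≈v_ : ∀ {d} → Vect d → Vect d → Set ℓ
  x ≈v y = ∀ t → x t ≈ y t

  _+v_ _-v_ : ∀ {d} → Vect d → Vect d → Vect d
  (x +v y) t = x t + y t
  (x -v y) t = x t - y t

  0v : ∀ {d} → Vect d
  0v t = 0#

  Σv : ∀ {d n} → (Fin n → Vect d) → Vect d
  Σv {n = zero}  f = 0v
  Σv {n = suc n} f = f zero +v Σv (λ i → f (suc i))

  ΣSub : ∀ {d k} → Subset k → (Fin k → Vect d) → Vect d
  ΣSub I P = Σv (λ i t → if lookup I i then P i t else 0#)

  InΩ : ∀ {d k} → ℕ → (Fin k → Vect d) → Vect d → Set ℓ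
  InΩ l P x = ∃[ I ] ∃[ J ] (∣ I ∣ ≡ l × ∣ J ∣ ≡ l × (∀ i → i ∈ I → i ∉ J) ×
                              x ≈v (ΣSub I P -v ΣSub J P))

  IsVectorFlow : (G : Graph) {d : ℕ} → (Vect d → Set ℓ) →
                 Orientation G → (Fin (nE G) → Vect d) → Set ℓ
  IsVectorFlow G Ω D f =
    (∀ e → Ω (f e)) ×
    (∀ v → (Σv (λ e → if tail G D e == v then f e else 0v)
            -v Σv (λ e → if head G D e == v then f e else 0v)) ≈v 0v)

  HasVectorFlow : (G : Graph) {d : ℕ} → (Vect d → Set ℓ) → Set (c Level.⊔ ℓ)
  HasVectorFlow G {d} Ω = Σ (Orientation G) λ D → Σ (Fin (nE G) → Vect d) λ f →
                          IsVectorFlow G Ω D f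

-- Orient every edge from tl to hd. A directed cycle C then gives the scalar
-- circulation taking the value 1, -1 or 0 on e according as C traverses e
-- forwards, backwards or not at all, and any combination Σᵢ φᵢ Pᵢ of
-- circulations φᵢ with coefficient vectors Pᵢ is a vector circulation. For the
-- cycles of the cover its value at e is Σ_{i ∈ I} Pᵢ - Σ_{j ∈ J} Pⱼ, where I and
-- J are the l cycles traversing e forwards and the l traversing it backwards,
-- so it lies in Ω.
module Submission where

open import Defs
open import Level using (Level)
open import Data.Nat using (ℕ; _≤_; zero; suc)
open import Data.Fin using (Fin; zero; suc)
open import Data.Fin.Subset using (Subset; _∈_; ∣_∣)
open import Data.Bool using (Bool; true; false; if_then_else_)
open import Data.Vec using (tabulate; lookup)
open import Data.Vec.Properties using (lookup∘tabulate; []=⇒lookup)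
open import Data.Vec.Functional using (Vector)
open import Data.Product using (_,_; uncurry)
open import Function using (_∘_)
open import Relation.Binary.PropositionalEquality as ≡ using (_≡_; _≢_)
open import Algebra.Bundles using (AbelianGroup; CommutativeRing)

∣tabulate∣≡count : ∀ {n} (p : Fin n → Bool) → ∣ tabulate p ∣ ≡ count p
∣tabulate∣≡count {zero}  p = ≡.refl
∣tabulate∣≡count {suc n} p with p zero
... | true  = ≡.cong suc (∣tabulate∣≡count (p ∘ suc))
... | false = ∣tabulate∣≡count (p ∘ suc)

∈tabulate⇒ : ∀ {n} {p : Fin n → Bool} {i} → i ∈ tabulate p → p i ≡ true
∈tabulate⇒ {p = p} {i} i∈ = ≡.trans (≡.sym (lookup∘tabulate p i)) ([]=⇒lookup i∈)

isFwd⇒¬isBwd : ∀ {u} → isFwd u ≡ true → isBwd u ≢ true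
isFwd⇒¬isBwd {absent} ()
isFwd⇒¬isBwd {fwd}    _ ()
isFwd⇒¬isBwd {bwd}    ()

module AbelianGroupSum {a ℓ} (G : AbelianGroup a ℓ) where
  open AbelianGroup G
  open import Algebra.Properties.AbelianGroup G using (ε⁻¹≈ε; ⁻¹-∙-comm)
  open import Algebra.Properties.CommutativeMonoid.Sum commutativeMonoid using (sum; ∑-distrib-+)

  ⁻¹-distrib-sum : ∀ {n} (f : Vector Carrier n) → sum (λ i → f i ⁻¹) ≈ sum f ⁻¹
  ⁻¹-distrib-sum {zero}  f = sym ε⁻¹≈ε
  ⁻¹-distrib-sum {suc n} f = trans (∙-congˡ (⁻¹-distrib-sum (f ∘ suc))) (⁻¹-∙-comm _ _)

  ∑-distrib-‿- : ∀ {n} (f g : Vector Carrier n) → sum (λ i → f i - g i) ≈ sum f - sum g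
  ∑-distrib-‿- f g = trans (∑-distrib-+ f (λ i → g i ⁻¹)) (∙-congˡ (⁻¹-distrib-sum g))

module _ {c ℓ : Level} (R : CommutativeRing c ℓ) where
  open CommutativeRing R hiding (zero)
  open Over R
  open import Algebra.Properties.Semiring.Sum semiring
    using (sum; sum-cong-≋; sum-replicate-zero; ∑-comm; *-distribˡ-sum; *-distribʳ-sum)
  open import Algebra.Properties.AbelianGroup +-abelianGroup using (ε⁻¹≈ε; ⁻¹-anti-homo‿-)
  open import Algebra.Properties.Ring ring using (-‿distribʳ-*; [y-z]x≈yx-zx)
  open import Algebra.Definitions.RawMonoid +-rawMonoid using (_×_)
  open import Relation.Binary.Reasoning.Setoid setoid
  open AbelianGroupSum +-abelianGroup using (∑-distrib-‿-)

  Σv-coordinate : ∀ {d n} (f : Fin n → Vect d) t → Σv f t ≈ sum (λ i → f i t)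
  Σv-coordinate {n = zero}  f t = refl
  Σv-coordinate {n = suc n} f t = +-congˡ (Σv-coordinate (f ∘ suc) t)

  indicator : Bool → Carrier
  indicator b = if b then 1# else 0#

  sum-indicator≈count : ∀ {n} (p : Fin n → Bool) → sum (λ i → indicator (p i)) ≈ count p × 1#
  sum-indicator≈count {zero}  p = refl
  sum-indicator≈count {suc n} p with p zero
  ... | true  = +-congˡ (sum-indicator≈count (p ∘ suc))
  ... | false = trans (+-identityˡ _) (sum-indicator≈count (p ∘ suc))

  if-then-0≈indicator* : ∀ b x → (if b then x else 0#) ≈ indicator b * x
  if-then-0≈indicator* true  x = sym (*-identityˡ x)
  if-then-0≈indicator* false x = sym (zeroˡ x)

  if-then-0v-coordinate : ∀ {d} b (x : Vect d) t → (if b then x else 0v) t ≈ indicator b * x t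
  if-then-0v-coordinate true  x t = sym (*-identityˡ (x t))
  if-then-0v-coordinate false x t = sym (zeroˡ (x t))

  Σv-restricted-coordinate : ∀ {d n} (p : Fin n → Bool) (f : Fin n → Vect d) t →
    Σv (λ i → if p i then f i else 0v) t ≈ sum (λ i → indicator (p i) * f i t)
  Σv-restricted-coordinate p f t =
    trans (Σv-coordinate (λ i → if p i then f i else 0v) t)
          (sum-cong-≋ λ i → if-then-0v-coordinate (p i) (f i) t)

  ΣSub-tabulate : ∀ {d k} (p : Fin k → Bool) (P : Fin k → Vect d) t →
                  ΣSub (tabulate p) P t ≈ sum (λ i → indicator (p i) * P i t)
  ΣSub-tabulate p P t =
    trans (Σv-coordinate (λ i t → if lookup (tabulate p) i then P i t else 0#) t) (sum-cong-≋ λ i →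
      trans (reflexive (≡.cong (λ b → if b then P i t else 0#) (lookup∘tabulate p i)))
            (if-then-0≈indicator* (p i) (P i t)))

  signedIndicator : Use → Carrier
  signedIndicator u = indicator (isFwd u) - indicator (isBwd u)

  module _ (G : Graph) where

    incidence : Fin (nV G) → Fin (nE G) → Carrier
    incidence v e = indicator (tl G e == v) - indicator (hd G e == v)

    IsCirculation : (Fin (nE G) → Carrier) → Set ℓ
    IsCirculation g = ∀ v → sum (λ e → incidence v e * g e) ≈ 0#

    kirchhoff-coordinate : ∀ {d} (f : Fin (nE G) → Vect d) v t →
      Σv (λ e → if tl G e == v then f e else 0v) t - Σv (λ e → if hd G e == v then f e else 0v) t
        ≈ sum (λ e → incidence v e * f e t)
    kirchhoff-coordinate f v t = begin
      Σv (λ e → if tl G e == v then f e else 0v) t - Σv (λ e → if hd G e == v then f e else 0v) t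
        ≈⟨ +-cong (Σv-restricted-coordinate _ f t) (-‿cong (Σv-restricted-coordinate _ f t)) ⟩
      sum outgoing - sum incoming
        ≈⟨ ∑-distrib-‿- outgoing incoming ⟨
      sum (λ e → outgoing e - incoming e)
        ≈⟨ sum-cong-≋ (λ e → [y-z]x≈yx-zx (f e t) _ _) ⟨
      sum (λ e → incidence v e * f e t) ∎
      where
      outgoing incoming : Fin (nE G) → Carrier
      outgoing e = indicator (tl G e == v) * f e t
      incoming e = indicator (hd G e == v) * f e t

    incidence*signedIndicator : ∀ (C : Fin (nE G) → Use) v e →
      incidence v e * signedIndicator (C e) ≈ indicator (leaves G C v e) - indicator (enters G C v e)
    incidence*signedIndicator C v e with C e
    ... | absent = trans (*-congˡ (-‿inverseʳ 0#)) (trans (zeroʳ _) (sym (-‿inverseʳ 0#)))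
    ... | fwd    = trans (*-congˡ (trans (+-congˡ ε⁻¹≈ε) (+-identityʳ 1#))) (*-identityʳ _)
    ... | bwd    = begin
      incidence v e * (0# - 1#)  ≈⟨ *-congˡ (+-identityˡ (- 1#)) ⟩
      incidence v e * - 1#       ≈⟨ -‿distribʳ-* _ 1# ⟨
      - (incidence v e * 1#)     ≈⟨ -‿cong (*-identityʳ _) ⟩
      - incidence v e            ≈⟨ ⁻¹-anti-homo‿- _ _ ⟩
      indicator (hd G e == v) - indicator (tl G e == v) ∎

    directedCycle⇒circulation : ∀ {C} → IsDirectedCycle G C → IsCirculation (signedIndicator ∘ C)
    directedCycle⇒circulation {C} balanced v = begin
      sum (λ e → incidence v e * signedIndicator (C e))
        ≈⟨ sum-cong-≋ (incidence*signedIndicator C v) ⟩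
      sum (λ e → indicator (leaves G C v e) - indicator (enters G C v e))
        ≈⟨ ∑-distrib-‿- (indicator ∘ leaves G C v) (indicator ∘ enters G C v) ⟩
      sum (indicator ∘ leaves G C v) - sum (indicator ∘ enters G C v)
        ≈⟨ +-cong (sum-indicator≈count (leaves G C v)) (-‿cong (sum-indicator≈count (enters G C v))) ⟩
      count (leaves G C v) × 1# - count (enters G C v) × 1#
        ≡⟨ ≡.cong (λ n → n × 1# - count (enters G C v) × 1#) (balanced v) ⟩
      count (enters G C v) × 1# - count (enters G C v) × 1#
        ≈⟨ -‿inverseʳ _ ⟩
      0# ∎

    linearCombination-circulation : ∀ {k} (g : Fin k → Fin (nE G) → Carrier) (x : Fin k → Carrier) →
      (∀ i → IsCirculation (g i)) → IsCirculation (λ e → sum (λ i → g i e * x i))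
    linearCombination-circulation {k} g x circ v = begin
      sum (λ e → incidence v e * sum (λ i → g i e * x i))
        ≈⟨ sum-cong-≋ {nE G} (λ e → trans (*-distribˡ-sum (incidence v e) (λ i → g i e * x i))
                                          (sum-cong-≋ {k} λ i → sym (*-assoc _ _ _))) ⟩
      sum (λ e → sum (λ i → (incidence v e * g i e) * x i))
        ≈⟨ ∑-comm (λ e i → (incidence v e * g i e) * x i) ⟩
      sum (λ i → sum (λ e → (incidence v e * g i e) * x i))
        ≈⟨ sum-cong-≋ {k} (λ i → trans (sym (*-distribʳ-sum (x i) (λ e → incidence v e * g i e)))
                                       (trans (*-congʳ (circ i v)) (zeroˡ (x i)))) ⟩
      sum {k} (λ _ → 0#)
        ≈⟨ sum-replicate-zero k ⟩
      0# ∎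

    circulation-resp-≈ : ∀ {g h : Fin (nE G) → Carrier} → (∀ e → g e ≈ h e) →
                         IsCirculation g → IsCirculation h
    circulation-resp-≈ g≈h circ v = trans (sum-cong-≋ (λ e → *-congˡ (sym (g≈h e)))) (circ v)

    circulations⇒vectorFlow : ∀ {d} (Ω : Vect d → Set ℓ) {f : Fin (nE G) → Vect d} →
      (∀ e → Ω (f e)) → (∀ t → IsCirculation (λ e → f e t)) → IsVectorFlow G Ω (λ _ → true) f
    circulations⇒vectorFlow Ω {f} f∈Ω circ =
      f∈Ω , λ v t → trans (kirchhoff-coordinate f v t) (circ t v)

    module _ {d k : ℕ} (C : Fin k → Fin (nE G) → Use) (P : Fin k → Vect d) where

      forwardSet backwardSet : Fin (nE G) → Subset k
      forwardSet  e = tabulate (λ i → isFwd (C i e))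
      backwardSet e = tabulate (λ i → isBwd (C i e))

      coverFlow : Fin (nE G) → Vect d
      coverFlow e = ΣSub (forwardSet e) P -v ΣSub (backwardSet e) P

      coverFlow-coordinate : ∀ e t → coverFlow e t ≈ sum (λ i → signedIndicator (C i e) * P i t)
      coverFlow-coordinate e t = begin
        ΣSub (forwardSet e) P t - ΣSub (backwardSet e) P t
          ≈⟨ +-cong (ΣSub-tabulate _ P t) (-‿cong (ΣSub-tabulate _ P t)) ⟩
        sum forward - sum backward
          ≈⟨ ∑-distrib-‿- forward backward ⟨
        sum (λ i → forward i - backward i)
          ≈⟨ sum-cong-≋ (λ i → [y-z]x≈yx-zx (P i t) _ _) ⟨
        sum (λ i → signedIndicator (C i e) * P i t) ∎
        where
        forward backward : Fin k → Carrier
        forward  i = indicator (isFwd (C i e)) * P i t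
        backward i = indicator (isBwd (C i e)) * P i t

      coverFlow-∈Ω : ∀ {l} e → count (λ i → isFwd (C i e)) ≡ l → count (λ i → isBwd (C i e)) ≡ l →
                     InΩ l P (coverFlow e)
      coverFlow-∈Ω e #fwd≡l #bwd≡l =
        forwardSet e , backwardSet e ,
        ≡.trans (∣tabulate∣≡count (λ i → isFwd (C i e))) #fwd≡l ,
        ≡.trans (∣tabulate∣≡count (λ i → isBwd (C i e))) #bwd≡l ,
        (λ i i∈I i∈J → isFwd⇒¬isBwd (∈tabulate⇒ i∈I) (∈tabulate⇒ i∈J)) ,
        λ t → refl

      coverFlow-circulation : (∀ i → IsDirectedCycle G (C i)) →
                              ∀ t → IsCirculation (λ e → coverFlow e t)
      coverFlow-circulation cycles t =
        circulation-resp-≈ (λ e → sym (coverFlow-coordinate e t))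
          (linearCombination-circulation (λ i → signedIndicator ∘ C i) (λ i → P i t)
            (λ i → directedCycle⇒circulation (cycles i)))

theorem4p1 : ∀ {c ℓ} (R : CommutativeRing c ℓ) (G : Graph) (d k l : ℕ) →
    Bridgeless G → 2 ≤ d → 2 ≤ k → 1 ≤ l →
    (C : Fin k → Fin (nE G) → Use) → IsOrientedCycleCover G k l C →
    (P : Fin k → Over.Vect R d) →
    Over.HasVectorFlow R G (Over.InΩ R l P)
theorem4p1 R G d k l _ _ _ _ C (cycles , cover) P =
  (λ _ → true) , coverFlow R G C P ,
  circulations⇒vectorFlow R G (Over.InΩ R l P)
    (λ e → uncurry (coverFlow-∈Ω R G C P e) (cover e))
    (coverFlow-circulation R G C P cycles)
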